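{- Let $k\ge 2$. In $GP(2k+1,2)$, for the outer vertices $u_0$ and $u_r$ with $1\le r\le k$ and $r>5$, no geodesic joining $u_0$ and $u_r$ is contained in the outer cycle.
   Context: For an integer $n\ge 5$, $GP(n,2)$ is the graph with vertex set $\{u_0,\dots,u_{n-1},v_0,\dots,v_{n-1}\}$ and edges $u_iu_{i+1}$ (outer edges), $u_iv_i$ (spokes) and $v_iv_{i+2}$ (inner edges) for $0\le i\le n-1$, subscripts modulo $n$. The outer cycle is the cycle $u_0u_1\cdots u_{n-1}u_0$. A geodesic is a shortest path. -}

module Defs where

open import Data.Nat using (ℕ; suc; _+_; _*_; _≤_; _%_; NonZero)
open import Data.Fin using (Fin; toℕ)
open import Data.Product using (_×_; _,_; Σ)
open import Data.Sum using (_⊎_)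
open import Data.List using (List; []; _∷_; length; head; last)
open import Data.Maybe using (just)
open import Data.List.Relation.Unary.All using (All)
open import Data.List.Relation.Unary.Unique.Propositional using (Unique)
open import Relation.Binary.PropositionalEquality using (_≡_)

data Vertex (n : ℕ) : Set where
  u : Fin n → Vertex n
  v : Fin n → Vertex n

_+[_]≡_mod_ : {n : ℕ} → Fin n → ℕ → Fin n → (m : ℕ) → .{{NonZero m}} → Set
i +[ d ]≡ j mod m = (toℕ i + d) % m ≡ toℕ j

data Gen (n : ℕ) .{{_ : NonZero n}} : Vertex n → Vertex n → Set where
  outer : ∀ {i j} → i +[ 1 ]≡ j mod n → Gen n (u i) (u j)
  spoke : ∀ i → Gen n (u i) (v i)
  inner : ∀ {i j} → i +[ 2 ]≡ j mod n → Gen n (v i) (v j)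

Adj : (n : ℕ) .{{_ : NonZero n}} → Vertex n → Vertex n → Set
Adj n x y = Gen n x y ⊎ Gen n y x

data IsWalk (n : ℕ) .{{_ : NonZero n}} : List (Vertex n) → Set where
  single : ∀ x → IsWalk n (x ∷ [])
  step   : ∀ {x y xs} → Adj n x y → IsWalk n (y ∷ xs) → IsWalk n (x ∷ y ∷ xs)

WalkFromTo : (n : ℕ) .{{_ : NonZero n}} → Vertex n → Vertex n → List (Vertex n) → Set
WalkFromTo n a b xs = IsWalk n xs × (head xs ≡ just a) × (last xs ≡ just b)

PathFromTo : (n : ℕ) .{{_ : NonZero n}} → Vertex n → Vertex n → List (Vertex n) → Set
PathFromTo n a b xs = WalkFromTo n a b xs × Unique xs

-- A geodesic: a path from a to b no longer (in vertex count, equivalently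
-- edge count) than any walk from a to b.
Geodesic : (n : ℕ) .{{_ : NonZero n}} → Vertex n → Vertex n → List (Vertex n) → Set
Geodesic n a b xs = PathFromTo n a b xs ×
  (∀ ys → WalkFromTo n a b ys → length xs ≤ length ys)

IsOuter : {n : ℕ} → Vertex n → Set
IsOuter (u _) = Data.Unit.⊤ where import Data.Unit
IsOuter (v _) = Data.Empty.⊥ where import Data.Empty

-- A path is contained in the outer cycle iff all its vertices are outer
-- vertices (the only edges between outer vertices are outer edges).
InOuterCycle : {n : ℕ} → List (Vertex n) → Set
InOuterCycle xs = All IsOuter xs

-- Along the outer cycle, the distance from u₀ on the n-cycle changes by at most
-- one per step, so an outer walk from u₀ to u_r needs at least min(r, n − r) = r
-- edges.  Going down the spoke at u₀, along inner edges v₀v₂…v_{2⌊r/2⌋}, back up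
-- a spoke and (for odd r) along one outer edge reaches u_r in ⌈r/2⌉ + 2 edges,
-- which is fewer than r once r > 5.
module Submission where

open import Defs
open import Data.Nat using (ℕ; zero; suc; _+_; _*_; _∸_; _⊓_; _≤_; _<_; z≤n; s≤s; s≤s⁻¹; NonZero; _%_; ⌈_/2⌉)
open import Data.Nat.Properties
open import Data.Nat.DivMod using (m<n⇒m%n≡m; n%n≡0)
open import Data.Fin using (Fin; zero; toℕ; fromℕ<)
open import Data.Fin.Properties using (toℕ-fromℕ<; toℕ-injective; toℕ<n)
open import Data.List using (List; []; _∷_; length; last)
open import Data.List.Relation.Unary.All using (All; _∷_)
open import Data.Maybe using (just)
open import Data.Product using (_×_; _,_; proj₁; proj₂)
open import Data.Sum using (inj₁; inj₂)
open import Relation.Nullary using (¬_)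
open import Relation.Binary.PropositionalEquality using (_≡_; refl; sym; trans; cong; subst)

cycleDist : ℕ → ℕ → ℕ
cycleDist n a = a ⊓ (n ∸ a)

cycleDist-small : ∀ {n a} → a + a ≤ n → cycleDist n a ≡ a
cycleDist-small {a = a} 2a≤n = m≤n⇒m⊓n≡m (m+n≤o⇒m≤o∸n a 2a≤n)

-- n ∸ a = suc s for s = n ∸ suc a, and both bounds pass through suc (a ⊓ s).
cycleDist-suc : ∀ {n a} → a < n →
  cycleDist n (suc a) ≤ suc (cycleDist n a) × cycleDist n a ≤ suc (cycleDist n (suc a))
cycleDist-suc {n} {a} a<n rewrite +-∸-assoc 1 a<n with n ∸ suc a
... | s = ≤-trans (⊓-monoʳ-≤ (suc a) (n≤1+n s)) (s≤s (⊓-monoʳ-≤ a (n≤1+n s)))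
        , ≤-trans (⊓-monoˡ-≤ (suc s) (n≤1+n a)) (s≤s (⊓-monoˡ-≤ s (n≤1+n a)))

cycleDist-% : ∀ {n a} .{{_ : NonZero n}} → a ≤ n → cycleDist n (a % n) ≡ cycleDist n a
cycleDist-% {n} {a} a≤n with m≤n⇒m<n∨m≡n a≤n
... | inj₁ a<n = cong (cycleDist n) (m<n⇒m%n≡m a<n)
... | inj₂ refl = trans (cong (cycleDist n) (n%n≡0 n)) (sym (trans (cong (n ⊓_) (n∸n≡0 n)) (⊓-zeroʳ n)))

module _ {n : ℕ} .{{_ : NonZero n}} where

  cycleDist-outerEdge : ∀ {i j : Fin n} → i +[ 1 ]≡ j mod n →
    cycleDist n (toℕ j) ≤ suc (cycleDist n (toℕ i)) × cycleDist n (toℕ i) ≤ suc (cycleDist n (toℕ j))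
  cycleDist-outerEdge {i} e rewrite sym e | +-comm (toℕ i) 1
                                  | cycleDist-% {n} {suc (toℕ i)} (toℕ<n i) = cycleDist-suc (toℕ<n i)

  cycleDist-outerAdj : ∀ {i j : Fin n} → Adj n (u i) (u j) → cycleDist n (toℕ j) ≤ suc (cycleDist n (toℕ i))
  cycleDist-outerAdj (inj₁ (outer e)) = proj₁ (cycleDist-outerEdge e)
  cycleDist-outerAdj (inj₂ (outer e)) = proj₂ (cycleDist-outerEdge e)

  cycleDist-outerWalk : ∀ {a b : Fin n} {xs} → IsWalk n (u a ∷ xs) → All IsOuter xs →
    last (u a ∷ xs) ≡ just (u b) → cycleDist n (toℕ b) ≤ cycleDist n (toℕ a) + length xs
  cycleDist-outerWalk (single _) _ refl = ≤-reflexive (sym (+-identityʳ _))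
  cycleDist-outerWalk {a} {b} {u c ∷ xs} (step adj w) (_ ∷ outers) end = begin
    cycleDist n (toℕ b)                     ≤⟨ cycleDist-outerWalk w outers end ⟩
    cycleDist n (toℕ c) + length xs         ≤⟨ +-monoˡ-≤ (length xs) (cycleDist-outerAdj adj) ⟩
    suc (cycleDist n (toℕ a)) + length xs   ≡⟨ sym (+-suc _ (length xs)) ⟩
    cycleDist n (toℕ a) + length (u c ∷ xs) ∎
    where open ≤-Reasoning

  +[]≡mod-noWrap : ∀ {i j : Fin n} {d} → toℕ i + d ≡ toℕ j → i +[ d ]≡ j mod n
  +[]≡mod-noWrap {j = j} e = trans (m<n⇒m%n≡m (subst (_< n) (sym e) (toℕ<n j))) e

  infixr 5 _∷_

  data Walk : Vertex n → Vertex n → ℕ → Set where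
    []  : ∀ {x} → Walk x x 0
    _∷_ : ∀ {x y z L} → Adj n x y → Walk y z L → Walk x z (suc L)

  verticesAfter : ∀ {x y L} → Walk x y L → List (Vertex n)
  verticesAfter []                = []
  verticesAfter (_∷_ {y = y} _ w) = y ∷ verticesAfter w

  vertices : ∀ {x y L} → Walk x y L → List (Vertex n)
  vertices {x} w = x ∷ verticesAfter w

  vertices-isWalk : ∀ {x y L} (w : Walk x y L) → IsWalk n (vertices w)
  vertices-isWalk []        = single _
  vertices-isWalk (adj ∷ w) = step adj (vertices-isWalk w)

  last-vertices : ∀ {x y L} (w : Walk x y L) → last (vertices w) ≡ just y
  last-vertices []      = refl
  last-vertices (_ ∷ w) = last-vertices w

  vertices-walkFromTo : ∀ {x y L} (w : Walk x y L) → WalkFromTo n x y (vertices w)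
  vertices-walkFromTo w = vertices-isWalk w , refl , last-vertices w

  length-vertices : ∀ {x y L} (w : Walk x y L) → length (vertices w) ≡ suc L
  length-vertices []      = refl
  length-vertices (_ ∷ w) = cong suc (length-vertices w)

  innerRoute : ∀ d {i j : Fin n} → toℕ i + d ≡ toℕ j → Walk (v i) (u j) (suc ⌈ d /2⌉)
  innerRoute zero {i} e with toℕ-injective {i = i} (trans (sym (+-identityʳ (toℕ i))) e)
  ... | refl = inj₂ (spoke i) ∷ []
  innerRoute (suc zero) {i} e = inj₂ (spoke i) ∷ inj₁ (outer (+[]≡mod-noWrap {i = i} e)) ∷ []
  innerRoute (suc (suc d)) {i} {j} e = inj₁ (inner (+[]≡mod-noWrap {i = i} i+2≡i′)) ∷ innerRoute d i′+d≡j
    where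
      i+2<n : toℕ i + 2 < n
      i+2<n = ≤-<-trans (≤-trans (m≤m+n (toℕ i + 2) d) (≤-reflexive (trans (+-assoc (toℕ i) 2 d) e))) (toℕ<n j)
      i′ : Fin n
      i′ = fromℕ< i+2<n
      i+2≡i′ : toℕ i + 2 ≡ toℕ i′
      i+2≡i′ = sym (toℕ-fromℕ< i+2<n)
      i′+d≡j : toℕ i′ + d ≡ toℕ j
      i′+d≡j = trans (cong (_+ d) (sym i+2≡i′)) (trans (+-assoc (toℕ i) 2 d) e)

  shortcut : ∀ d {i j : Fin n} → toℕ i + d ≡ toℕ j → Walk (u i) (u j) (2 + ⌈ d /2⌉)
  shortcut d {i} e = inj₁ (spoke i) ∷ innerRoute d e

2+⌈n/2⌉<n : ∀ {n} → 5 < n → 2 + ⌈ n /2⌉ < n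
2+⌈n/2⌉<n (s≤s (s≤s (s≤s (s≤s (s≤s (s≤s (z≤n {m}))))))) =
  s≤s (s≤s (s≤s (s≤s (s≤s (s≤s (⌈n/2⌉≤n m))))))

mainTheorem10 : (k r : ℕ) → 2 ≤ k → 1 ≤ r → r ≤ k → 5 < r →
    (r<n : r < suc (2 * k)) → (P : List (Vertex (suc (2 * k)))) →
    Geodesic (suc (2 * k)) (u zero) (u (fromℕ< r<n)) P → ¬ InOuterCycle P
mainTheorem10 k r _ _ r≤k 5<r r<n (_ ∷ xs) (((w , refl , end) , _) , minimal) (_ ∷ outers) =
  <⇒≱ (2+⌈n/2⌉<n 5<r) (≤-trans outerLength (s≤s⁻¹ shortcutLength))
  where
    N : ℕ
    N = suc (2 * k)
    route : Walk (u zero) (u (fromℕ< r<n)) (2 + ⌈ r /2⌉)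
    route = shortcut r (sym (toℕ-fromℕ< r<n))
    r+r≤N : r + r ≤ N
    r+r≤N = m≤n⇒m≤1+n (+-mono-≤ r≤k (≤-trans r≤k (≤-reflexive (sym (+-identityʳ k)))))
    outerLength : r ≤ length xs
    outerLength = begin
      r                              ≡⟨ sym (cycleDist-small r+r≤N) ⟩
      cycleDist N r                  ≡⟨ cong (cycleDist N) (sym (toℕ-fromℕ< r<n)) ⟩
      cycleDist N (toℕ (fromℕ< r<n)) ≤⟨ cycleDist-outerWalk w outers end ⟩
      length xs                      ∎
      where open ≤-Reasoning
    shortcutLength : suc (length xs) ≤ suc (2 + ⌈ r /2⌉)
    shortcutLength = ≤-trans (minimal _ (vertices-walkFromTo route)) (≤-reflexive (length-vertices route))
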